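{- Let $G$ be a finite simple graph and let $i$ and $j$ be positive integers. Then $G$ is an $\langle i,j\rangle$ competition graph if and only if there is an edge clique cover $\mathcal{C}=\{C_1,\ldots,C_p\}$ of $G$ satisfying all of the following: (i) $|C_t|\le i$ for each $1\le t\le p$; (ii) each vertex of $G$ belongs to at most $j$ cliques in $\mathcal{C}$; (iii) the family $\{V(G)-C_1,\ldots,V(G)-C_p\}$ has a system of distinct representatives; (iv) $p\le |V(G)|$.
   Context: All digraphs are finite, without loops and without parallel arcs; all graphs are finite and simple. The competition graph $C(D)$ of a digraph $D$ has vertex set $V(D)$ and an edge $uv$ ($u\neq v$) if and only if $u$ and $v$ have a common out-neighbor in $D$. For positive integers $i,j$, an $\langle i,j\rangle$ digraph is a loopless digraph in which every vertex $x$ has indegree $d^-(x)\le i$ and outdegree $d^+(x)\le j$ (it need not be acyclic). A graph is an $\langle i,j\rangle$ competition graph if it is the competition graph of some $\langle i,j\rangle$ digraph. A clique is identified with its vertex set; an edge clique cover of $G$ is a collection of cliques of $G$ covering all edges of $G$. A system of distinct representatives (SDR) of a family $\{A_1,\ldots,A_m\}$ of sets is a collection of distinct elements $a_1,\ldots,a_m$ with $a_t\in A_t$ for each $t$. -}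

module Defs where

open import Data.Nat using (ℕ; _≤_)
open import Data.Bool using (Bool; true; false)
open import Data.Fin using (Fin)
open import Data.Fin.Subset using (∣_∣)
open import Data.Vec using (tabulate)
open import Data.Product using (Σ; ∃; _×_)
open import Relation.Binary.PropositionalEquality using (_≡_; _≢_)
open import Relation.Nullary using (¬_)
open import Function.Definitions using (Injective)
open import Function.Bundles using (_⇔_)

card : {n : ℕ} → (Fin n → Bool) → ℕ
card f = ∣ tabulate f ∣

record Graph (n : ℕ) : Set where
  field
    adj   : Fin n → Fin n → Bool
    sym   : ∀ u v → adj u v ≡ adj v u
    irrefl : ∀ u → adj u u ≡ false
open Graph public

record Digraph (n : ℕ) : Set where
  field
    arc      : Fin n → Fin n → Bool
    loopless : ∀ u → arc u u ≡ false
open Digraph public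

outdeg : {n : ℕ} → Digraph n → Fin n → ℕ
outdeg D x = card (λ y → arc D x y)

indeg : {n : ℕ} → Digraph n → Fin n → ℕ
indeg D y = card (λ x → arc D x y)

IsIJDigraph : {n : ℕ} → ℕ → ℕ → Digraph n → Set
IsIJDigraph i j D = ∀ x → indeg D x ≤ i × outdeg D x ≤ j

IsCompetitionGraphOf : {n : ℕ} → Graph n → Digraph n → Set
IsCompetitionGraphOf {n} G D =
  ∀ u v → (adj G u v ≡ true) ⇔ (u ≢ v × ∃ λ (w : Fin n) → arc D u w ≡ true × arc D v w ≡ true)

IsIJCompetitionGraph : {n : ℕ} → ℕ → ℕ → Graph n → Set
IsIJCompetitionGraph {n} i j G = Σ (Digraph n) λ D → IsIJDigraph i j D × IsCompetitionGraphOf G D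

IsClique : {n : ℕ} → Graph n → (Fin n → Bool) → Set
IsClique G C = ∀ u v → C u ≡ true → C v ≡ true → u ≢ v → adj G u v ≡ true

IsEdgeCliqueCover : {n p : ℕ} → Graph n → (Fin p → Fin n → Bool) → Set
IsEdgeCliqueCover {n} {p} G C =
  (∀ t → IsClique G (C t)) ×
  (∀ u v → adj G u v ≡ true → ∃ λ (t : Fin p) → C t u ≡ true × C t v ≡ true)

HasComplementSDR : {n p : ℕ} → (Fin p → Fin n → Bool) → Set
HasComplementSDR {n} {p} C =
  Σ (Fin p → Fin n) λ r → Injective _≡_ _≡_ r × (∀ t → C t (r t) ≡ false)

-- A digraph D yields the cover of C(D) by the in-neighbourhoods of its vertices: there are
-- n of them, their sizes are the indegrees, a vertex lies in as many as its outdegree, and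
-- since D is loopless every vertex w represents the complement of its own in-neighbourhood.
-- Conversely, given such a cover with SDR r, let every vertex of C_t point to r(t): the
-- in-neighbourhood of r(t) is exactly C_t (r is injective), the out-neighbours of x are the
-- images under r of the cliques containing x, and r(t) ∉ C_t rules out loops.
module Submission where

open import Defs hiding (sym)
open import Data.Nat using (ℕ; _≤_; zero; suc; z≤n; s≤s)
open import Data.Nat.Properties using (≤-refl; ≤-trans; n≤1+n)
open import Data.Bool using (Bool; true; false; if_then_else_)
open import Data.Fin using (Fin; zero; suc)
open import Data.Fin.Properties using (_≟_; any?; ¬Fin0)
open import Data.Product using (Σ; ∃; _×_; _,_; proj₁)
open import Data.Empty using (⊥-elim)
open import Relation.Nullary using (Dec; does; yes; no; ¬_; contradiction)
open import Relation.Binary.PropositionalEquality using (_≡_; _≢_; refl; sym; trans; subst)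
open import Function.Bundles using (_⇔_; mk⇔; Equivalence)
open import Function.Definitions using (Injective)

card-empty : {n : ℕ} (f : Fin n → Bool) → (∀ x → ¬ f x ≡ true) → card f ≡ 0
card-empty {zero}  f empty = refl
card-empty {suc n} f empty with f zero in fz
... | true  = contradiction fz (empty zero)
... | false = card-empty (λ x → f (suc x)) (λ x → empty (suc x))

-- `does` rather than ⌊_⌋, so that (f ─ suc y) ∘ suc reduces to (f ∘ suc) ─ y.
_─_ : {n : ℕ} → (Fin n → Bool) → Fin n → Fin n → Bool
(f ─ y) x = if does (x ≟ y) then false else f x

─-true : {n : ℕ} (f : Fin n → Bool) (y x : Fin n) → (f ─ y) x ≡ true → f x ≡ true × x ≢ y
─-true f y x e with x ≟ y
... | no x≢y = e , x≢y

card≤suc-card─ : {n : ℕ} (f : Fin n → Bool) (y : Fin n) → card f ≤ suc (card (f ─ y))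
card≤suc-card─ f zero with f zero
... | true  = ≤-refl
... | false = n≤1+n _
card≤suc-card─ f (suc y) with f zero
... | true  = s≤s (card≤suc-card─ (λ x → f (suc x)) y)
... | false = card≤suc-card─ (λ x → f (suc x)) y

card-image≤ : {n p : ℕ} (r : Fin p → Fin n) (g : Fin p → Bool) (f : Fin n → Bool) →
              (∀ y → f y ≡ true → ∃ λ t → g t ≡ true × r t ≡ y) → card f ≤ card g
card-image≤ {p = zero} r g f onto
  rewrite card-empty f (λ y fy → ¬Fin0 (proj₁ (onto y fy))) = z≤n
card-image≤ {p = suc p} r g f onto with g zero in gz
... | true  = ≤-trans (card≤suc-card─ f (r zero))
                      (s≤s (card-image≤ (λ t → r (suc t)) (λ t → g (suc t)) (f ─ r zero) onto─))
  where
  onto─ : ∀ y → (f ─ r zero) y ≡ true → ∃ λ t → g (suc t) ≡ true × r (suc t) ≡ y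
  onto─ y e with ─-true f (r zero) y e
  ... | fy , y≢r0 with onto y fy
  ...   | zero  , _  , r0≡y = contradiction (sym r0≡y) y≢r0
  ...   | suc t , gt , rt≡y = t , gt , rt≡y
... | false = card-image≤ (λ t → r (suc t)) (λ t → g (suc t)) f onto′
  where
  onto′ : ∀ y → f y ≡ true → ∃ λ t → g (suc t) ≡ true × r (suc t) ≡ y
  onto′ y fy with onto y fy
  ... | zero  , g0 , _ = contradiction (trans (sym gz) g0) λ ()
  ... | suc t , gt , rt≡y = t , gt , rt≡y

module CliqueCoverDigraph {n p : ℕ} (C : Fin p → Fin n → Bool) (r : Fin p → Fin n)
                          (r-injective : Injective _≡_ _≡_ r) (r∉C : ∀ t → C t (r t) ≡ false) where

  preimage : (y : Fin n) → Dec (∃ λ t → r t ≡ y)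
  preimage y = any? (λ t → r t ≟ y)

  arcFrom : {y : Fin n} → Dec (∃ λ t → r t ≡ y) → Fin n → Bool
  arcFrom (yes (t , _)) x = C t x
  arcFrom (no _)        x = false

  D : Digraph n
  D = record { arc = λ x y → arcFrom (preimage y) x ; loopless = λ y → no-loop (preimage y) }
    where
    no-loop : {y : Fin n} (d : Dec (∃ λ t → r t ≡ y)) → arcFrom d y ≡ false
    no-loop (yes (t , refl)) = r∉C t
    no-loop (no _)           = refl

  arc⇒clique : ∀ {x y} → arc D x y ≡ true → ∃ λ t → C t x ≡ true × r t ≡ y
  arc⇒clique {x} {y} = go (preimage y)
    where
    go : (d : Dec (∃ λ t → r t ≡ y)) → arcFrom d x ≡ true → ∃ λ t → C t x ≡ true × r t ≡ y
    go (yes (t , rt≡y)) e = t , e , rt≡y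

  clique⇒arc : ∀ {x} t → C t x ≡ true → arc D x (r t) ≡ true
  clique⇒arc {x} t = go (preimage (r t))
    where
    go : (d : Dec (∃ λ t′ → r t′ ≡ r t)) → C t x ≡ true → arcFrom d x ≡ true
    go (yes (t′ , rt′≡rt)) e = subst (λ s → C s x ≡ true) (sym (r-injective rt′≡rt)) e
    go (no ∄t)             _ = ⊥-elim (∄t (t , refl))

  indeg≤ : (i : ℕ) → (∀ t → card (C t) ≤ i) → ∀ y → indeg D y ≤ i
  indeg≤ i size y = go (preimage y)
    where
    go : (d : Dec (∃ λ t → r t ≡ y)) → card (λ x → arcFrom d x) ≤ i
    go (yes (t , _)) = size t
    go (no _) rewrite card-empty {n} (λ _ → false) (λ _ ()) = z≤n

  outdeg≤ : ∀ x → outdeg D x ≤ card (λ t → C t x)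
  outdeg≤ x = card-image≤ r (λ t → C t x) (arc D x) (λ y → arc⇒clique)

  competition : (G : Graph n) → IsEdgeCliqueCover G C → IsCompetitionGraphOf G D
  competition G (clique , cover) u v = mk⇔ to from
    where
    to : adj G u v ≡ true → u ≢ v × ∃ λ w → arc D u w ≡ true × arc D v w ≡ true
    to uv with cover u v uv
    ... | t , tu , tv = (λ { refl → contradiction (trans (sym uv) (irrefl G u)) λ () })
                      , r t , clique⇒arc t tu , clique⇒arc t tv
    from : u ≢ v × (∃ λ w → arc D u w ≡ true × arc D v w ≡ true) → adj G u v ≡ true
    from (u≢v , w , uw , vw) with arc⇒clique uw | arc⇒clique vw
    ... | t , tu , refl | t′ , t′v , rt′≡rt =
      clique t u v tu (subst (λ s → C s v ≡ true) (r-injective rt′≡rt) t′v) u≢v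

inNeighbourhood : {n : ℕ} → Digraph n → Fin n → Fin n → Bool
inNeighbourhood D w x = arc D x w

inNeighbourhoods-cover : {n : ℕ} (G : Graph n) (D : Digraph n) →
                         IsCompetitionGraphOf G D → IsEdgeCliqueCover G (inNeighbourhood D)
inNeighbourhoods-cover G D comp =
    (λ w u v uw vw u≢v → Equivalence.from (comp u v) (u≢v , w , uw , vw))
  , (λ u v uv → let (_ , w , uw , vw) = Equivalence.to (comp u v) uv in w , uw , vw)

inNeighbourhoods-SDR : {n : ℕ} (D : Digraph n) → HasComplementSDR (inNeighbourhood D)
inNeighbourhoods-SDR D = (λ w → w) , (λ e → e) , loopless D

theorem2p2 : (n : ℕ) (G : Graph n) (i j : ℕ) → 1 ≤ i → 1 ≤ j →
    IsIJCompetitionGraph i j G ⇔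
      (Σ ℕ λ p → Σ (Fin p → Fin n → Bool) λ C →
        IsEdgeCliqueCover G C
        × (∀ t → card (C t) ≤ i)
        × (∀ x → card (λ t → C t x) ≤ j)
        × HasComplementSDR C
        × p ≤ n)
theorem2p2 n G i j _ _ = mk⇔ toCover fromCover
  where
  toCover : IsIJCompetitionGraph i j G → _
  toCover (D , degrees , comp) =
    n , inNeighbourhood D , inNeighbourhoods-cover G D comp ,
    (λ w → let (inw , _) = degrees w in inw) , (λ x → let (_ , outx) = degrees x in outx) ,
    inNeighbourhoods-SDR D , ≤-refl
  fromCover : _ → IsIJCompetitionGraph i j G
  fromCover (p , C , cover , size , multiplicity , (r , r-injective , r∉C) , _) =
    D , (λ x → indeg≤ i size x , ≤-trans (outdeg≤ x) (multiplicity x)) , competition G cover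
    where open CliqueCoverDigraph C r r-injective r∉C
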